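{- For every $d\in\mathbb N$, the family of graphs with maximal degree $d$ has a labeling scheme (in the adversarial model described in the context) with labels of size $O(d\log d)$ bits and probability of forgery bounded by a constant strictly less than $1$.
   Context: A labeling scheme (adjacency sketch) for a family of graphs consists of a randomized encoder that, given a graph $G$ in the family, outputs a labeling $\ell:V(G)\to\{0,1\}^c$ ($c$ is the size), and a deterministic decoder $\mathcal D:\{0,1\}^*\times\{0,1\}^*\to\{0,1\}$; the scheme errs only on non-edges, i.e. $\mathcal D(\ell(u),\ell(v))=1$ always holds for edges $(u,v)$. Adversarial game: the adversary chooses $G$ in the family with $n$ vertices; labels are drawn by the encoder; the (computationally unbounded) adversary adaptively requests the labels of vertices $x_1,\dots,x_k$, $k\le n-2$, each choice possibly depending on earlier answers; it then names two distinct vertices $x_{k+1},x_{k+2}$ not previously queried. It wins if $(x_{k+1},x_{k+2})\notin E(G)$ but $\mathcal D(\ell(x_{k+1}),\ell(x_{k+2}))=1$. The probability of forgery is the maximum over adversaries of the winning probability. -}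

module Defs where

open import Data.Bool using (Bool; true; false; T; not; _∧_; _∨_)
open import Data.Nat using (ℕ; zero; suc; _≤_; _*_)
open import Data.Fin using (Fin; _≟_)
open import Data.List using (List; []; _∷_; length; allFin; filterᵇ)
open import Data.Bool.ListAction using (any)
open import Data.Vec using (Vec)
open import Data.Product using (Σ; _×_; _,_)
open import Relation.Nullary.Decidable using (⌊_⌋)
open import Relation.Binary.PropositionalEquality using (_≡_)

record Graph (n : ℕ) : Set where
  field
    adj    : Fin n → Fin n → Bool
    sym    : ∀ u v → adj u v ≡ adj v u
    irrefl : ∀ u → adj u u ≡ false
open Graph public

degree : ∀ {n} → Graph n → Fin n → ℕ
degree {n} G u = length (filterᵇ (adj G u) (allFin n))

MaxDegree≤ : ∀ {n} → ℕ → Graph n → Set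
MaxDegree≤ {n} d G = ∀ (u : Fin n) → degree G u ≤ d

Label : ℕ → Set
Label c = Vec Bool c

Labeling : ℕ → ℕ → Set
Labeling n c = Fin n → Label c

-- The randomized encoder: for each graph in the family, a finite nonempty
-- seed space Fin (suc m) (uniform distribution) and a labeling per seed.
record Scheme (d c : ℕ) : Set where
  field
    seeds    : ∀ {n} (G : Graph n) → MaxDegree≤ d G → ℕ
    encode   : ∀ {n} (G : Graph n) (h : MaxDegree≤ d G) →
               Fin (suc (seeds G h)) → Labeling n c
    decode   : Label c → Label c → Bool
    complete : ∀ {n} (G : Graph n) (h : MaxDegree≤ d G)
               (s : Fin (suc (seeds G h))) (u v : Fin n) →
               adj G u v ≡ true → decode (encode G h s u) (encode G h s v) ≡ true
open Scheme public

-- An adaptive (computationally unbounded) adversary making k label queries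
-- on an n-vertex graph with labels of size c: a decision tree.
-- 'query x f' requests the label of x and continues with f applied to the answer;
-- 'guess y z' names the final pair.
data Adversary (n c : ℕ) : ℕ → Set where
  guess : Fin n → Fin n → Adversary n c zero
  query : ∀ {k} → Fin n → (Label c → Adversary n c k) → Adversary n c (suc k)

run : ∀ {n c k} → Adversary n c k → Labeling n c → List (Fin n) × (Fin n × Fin n)
run (guess y z)   ℓ = [] , (y , z)
run (query x f)   ℓ with run (f (ℓ x)) ℓ
... | qs , p = (x ∷ qs) , p

wins : ∀ {n c k} → (Label c → Label c → Bool) → Graph n → Labeling n c →
       Adversary n c k → Bool
wins D G ℓ A with run A ℓ
... | qs , (y , z) =
  not ⌊ y ≟ z ⌋
  ∧ not (any (λ x → ⌊ x ≟ y ⌋ ∨ ⌊ x ≟ z ⌋) qs)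
  ∧ not (adj G y z)
  ∧ D (ℓ y) (ℓ z)

winCount : ∀ {d c} (S : Scheme d c) {n k} (G : Graph n) (h : MaxDegree≤ d G) →
           Adversary n c k → ℕ
winCount S {n} G h A =
  length (filterᵇ (λ s → wins (decode S) G (encode S G h s) A)
                  (allFin (suc (seeds S G h))))

-- Probability of forgery of S is at most p/q:
-- for every n, every graph G of max degree ≤ d on n vertices, every k ≤ n-2 and
-- every adaptive adversary with k queries, Pr[win] = winCount/(seeds+1) ≤ p/q.
ForgeryAtMost : ∀ {d c} → Scheme d c → ℕ → ℕ → Set
ForgeryAtMost {d} {c} S p q =
  ∀ {n} (G : Graph n) (h : MaxDegree≤ d G) (k : ℕ) → suc (suc k) ≤ n →
  (A : Adversary n c k) →
  q * winCount S G h A ≤ p * suc (seeds S G h)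

{-# OPTIONS --safe #-}
-- Labels are vectors in 𝔽₂^c with c = 2d + 2, the decoder accepts a pair iff the two labels are
-- orthogonal, and the encoder draws a uniformly random labeling in which adjacent vertices get
-- orthogonal labels, so edges are always accepted.  Whatever the adversary has seen, the labels
-- of two unqueried non-adjacent vertices y, z are independent and uniform on the subspaces P, Q
-- of vectors orthogonal to the labels of their neighbours, each of dimension at least d + 2.
-- A vector a ∈ P is orthogonal to all of Q if a ∈ Qᗮ and to half of Q otherwise, and
-- |P ∩ Qᗮ| ≤ |Qᗮ| ≤ 2^c / |Q| ≤ |P| / 4, so a forgery succeeds with probability at most 5/8.
module Submission where

open import Defs hiding (sym)
open import Data.Bool using (Bool; true; false; _∧_; _∨_; not; _xor_; T?)
open import Data.Bool.ListAction using (all; any)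
open import Data.Bool.Properties
  using (∧-comm; ∧-conicalˡ; ∧-conicalʳ; ∨-conicalˡ; ∨-conicalʳ; xor-comm; true-xor; xor-identityʳ; not-injective; T-≡)
  renaming (_≟_ to _≟ᴮ_)
open import Data.Bool.Solver using (module ∨-∧-Solver; module xor-∧-Solver)
open import Data.Fin using (Fin; zero; suc; _≟_)
open import Data.List using (List; []; _∷_; _++_; map; concatMap; filterᵇ; length; allFin; tabulate)
import Data.List as List
open import Data.List.Membership.Propositional using (_∈_)
open import Data.List.Membership.Propositional.Properties
  using (∈-allFin; ∈-concatMap⁺; ∈-filter⁺; ∈-filter⁻; ∈-length; ∈-lookup; ∈-map⁺; ∈-map⁻)
open import Data.List.Properties using (length-map; map-tabulate; tabulate-lookup)
open import Data.List.Relation.Unary.Any using (here; there)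
import Data.List.Relation.Unary.Any as Any
open import Data.Nat using (ℕ; zero; suc; _+_; _*_; _^_; _≤_; _<_; z≤n; s≤s; _≡ᵇ_)
open import Data.Nat.Logarithm using (⌈log₂_⌉)
open import Data.Nat.Properties hiding (_≟_)
open import Algebra.Properties.CommutativeSemigroup +-commutativeSemigroup using (interchange)
import Algebra.Properties.CommutativeSemigroup *-commutativeSemigroup as *-CS
open import Data.Nat.Tactic.RingSolver using (solve-∀)
open import Data.Product using (Σ; ∃-syntax; _×_; _,_; proj₁; proj₂)
open import Data.Vec using (Vec; []; _∷_; lookup; _[_]≔_; replicate; zipWith)
open import Data.Vec.Properties using (≡-dec; lookup∘update; lookup∘update′; lookup-replicate)
open import Function using (_∘_; id; Equivalence)
open import Relation.Binary.Definitions using (DecidableEquality)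
open import Relation.Binary.PropositionalEquality
open import Relation.Nullary using (does; yes; no)
open import Relation.Nullary.Decidable using (⌊_⌋)

⟦_⟧ : Bool → ℕ
⟦ true  ⟧ = 1
⟦ false ⟧ = 0

⟦⟧≤1 : ∀ b → ⟦ b ⟧ ≤ 1
⟦⟧≤1 true  = s≤s z≤n
⟦⟧≤1 false = z≤n

⟦∧⟧ : ∀ a b → ⟦ a ∧ b ⟧ ≡ ⟦ a ⟧ * ⟦ b ⟧
⟦∧⟧ true  b = sym (+-identityʳ ⟦ b ⟧)
⟦∧⟧ false b = refl

⟦⟧-positive : ∀ {b} → 0 < ⟦ b ⟧ → b ≡ true
⟦⟧-positive {true} _ = refl

⟦⟧*-+-≤ : ∀ b x y → ⟦ b ⟧ * (x + y) ≤ ⟦ b ⟧ * x + y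
⟦⟧*-+-≤ true  x y = ≤-reflexive (trans (+-identityʳ (x + y)) (cong (_+ y) (sym (+-identityʳ x))))
⟦⟧*-+-≤ false x y = z≤n

∑ : {A : Set} → List A → (A → ℕ) → ℕ
∑ []       f = 0
∑ (x ∷ xs) f = f x + ∑ xs f

infixr 5 ∑
syntax ∑ xs (λ x → e) = ∑[ x ∈ xs ] e

module _ {A : Set} where

  ∑-cong : ∀ xs {f g : A → ℕ} → (∀ x → f x ≡ g x) → ∑ xs f ≡ ∑ xs g
  ∑-cong []       f≗g = refl
  ∑-cong (x ∷ xs) f≗g = cong₂ _+_ (f≗g x) (∑-cong xs f≗g)

  ∑-mono-≤ : ∀ xs {f g : A → ℕ} → (∀ x → f x ≤ g x) → ∑ xs f ≤ ∑ xs g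
  ∑-mono-≤ []       f≤g = z≤n
  ∑-mono-≤ (x ∷ xs) f≤g = +-mono-≤ (f≤g x) (∑-mono-≤ xs f≤g)

  ∑-zero : ∀ (xs : List A) → ∑[ x ∈ xs ] 0 ≡ 0
  ∑-zero []       = refl
  ∑-zero (x ∷ xs) = ∑-zero xs

  ∑-distrib-+ : ∀ xs (f g : A → ℕ) → ∑[ x ∈ xs ] (f x + g x) ≡ ∑ xs f + ∑ xs g
  ∑-distrib-+ []       f g = refl
  ∑-distrib-+ (x ∷ xs) f g =
    trans (cong (f x + g x +_) (∑-distrib-+ xs f g)) (interchange (f x) (g x) (∑ xs f) (∑ xs g))

  ∑-*ˡ : ∀ xs k (f : A → ℕ) → ∑[ x ∈ xs ] (k * f x) ≡ k * ∑ xs f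
  ∑-*ˡ []       k f = sym (*-zeroʳ k)
  ∑-*ˡ (x ∷ xs) k f = trans (cong (k * f x +_) (∑-*ˡ xs k f)) (sym (*-distribˡ-+ k (f x) (∑ xs f)))

  ∑-*ʳ : ∀ xs k (f : A → ℕ) → ∑[ x ∈ xs ] (f x * k) ≡ ∑ xs f * k
  ∑-*ʳ xs k f = trans (∑-cong xs (λ x → *-comm (f x) k)) (trans (∑-*ˡ xs k f) (*-comm k (∑ xs f)))

  ∑-const : ∀ (xs : List A) k → ∑[ x ∈ xs ] k ≡ k * length xs
  ∑-const []       k = sym (*-zeroʳ k)
  ∑-const (x ∷ xs) k = trans (cong (k +_) (∑-const xs k)) (sym (*-suc k (length xs)))

  ∑-++ : ∀ xs ys (f : A → ℕ) → ∑ (xs ++ ys) f ≡ ∑ xs f + ∑ ys f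
  ∑-++ []       ys f = refl
  ∑-++ (x ∷ xs) ys f = trans (cong (f x +_) (∑-++ xs ys f)) (sym (+-assoc (f x) (∑ xs f) (∑ ys f)))

  ∑-positive : ∀ xs (f : A → ℕ) → 0 < ∑ xs f → ∃[ x ] 0 < f x
  ∑-positive (x ∷ xs) f 0<∑ with f x in eq
  ... | suc _ = x , subst (0 <_) (sym eq) (s≤s z≤n)
  ... | zero  = ∑-positive xs f 0<∑

  ∑-filterᵇ : ∀ (p : A → Bool) xs f → ∑ (filterᵇ p xs) f ≡ ∑[ x ∈ xs ] ⟦ p x ⟧ * f x
  ∑-filterᵇ p []       f = refl
  ∑-filterᵇ p (x ∷ xs) f with p x
  ... | true  = cong₂ _+_ (sym (+-identityʳ (f x))) (∑-filterᵇ p xs f)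
  ... | false = ∑-filterᵇ p xs f

  length-filterᵇ : ∀ (p : A → Bool) xs → length (filterᵇ p xs) ≡ ∑[ x ∈ xs ] ⟦ p x ⟧
  length-filterᵇ p []       = refl
  length-filterᵇ p (x ∷ xs) with p x
  ... | true  = cong suc (length-filterᵇ p xs)
  ... | false = length-filterᵇ p xs

∑-swap : ∀ {A B : Set} xs ys (f : A → B → ℕ) →
         ∑[ x ∈ xs ] ∑[ y ∈ ys ] f x y ≡ ∑[ y ∈ ys ] ∑[ x ∈ xs ] f x y
∑-swap []       ys f = sym (∑-zero ys)
∑-swap (x ∷ xs) ys f = trans (cong (∑ ys (f x) +_) (∑-swap xs ys f))
                             (sym (∑-distrib-+ ys (f x) (λ y → ∑[ x ∈ xs ] f x y)))

∑-concatMap : ∀ {A B : Set} (g : A → List B) xs f → ∑ (concatMap g xs) f ≡ ∑[ x ∈ xs ] ∑ (g x) f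
∑-concatMap g []       f = refl
∑-concatMap g (x ∷ xs) f = trans (∑-++ (g x) (concatMap g xs) f) (cong (∑ (g x) f +_) (∑-concatMap g xs f))

∑-map : ∀ {A B : Set} (g : A → B) xs (f : B → ℕ) → ∑ (map g xs) f ≡ ∑[ x ∈ xs ] f (g x)
∑-map g []       f = refl
∑-map g (x ∷ xs) f = cong (f (g x) +_) (∑-map g xs f)

∑-lookup : ∀ {A : Set} xs (f : A → ℕ) → ∑[ i ∈ allFin (length xs) ] f (List.lookup xs i) ≡ ∑ xs f
∑-lookup xs f = begin
  ∑[ i ∈ allFin (length xs) ] f (List.lookup xs i) ≡⟨ sym (∑-map (List.lookup xs) (allFin (length xs)) f) ⟩
  ∑ (map (List.lookup xs) (tabulate id)) f          ≡⟨ cong (λ ys → ∑ ys f) (map-tabulate id (List.lookup xs)) ⟩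
  ∑ (tabulate (List.lookup xs)) f                   ≡⟨ cong (λ ys → ∑ ys f) (tabulate-lookup xs) ⟩
  ∑ xs f                                            ∎
  where open ≡-Reasoning

vectors : {A : Set} → List A → (n : ℕ) → List (Vec A n)
vectors xs zero    = [] ∷ []
vectors xs (suc n) = concatMap (λ a → map (a ∷_) (vectors xs n)) xs

module _ {A : Set} where

  ∑-vectors : ∀ (xs : List A) n f → ∑ (vectors xs (suc n)) f ≡ ∑[ a ∈ xs ] ∑[ v ∈ vectors xs n ] f (a ∷ v)
  ∑-vectors xs n f = trans (∑-concatMap _ xs f) (∑-cong xs (λ a → ∑-map (a ∷_) (vectors xs n) f))

  ∈-vectors : ∀ {xs : List A} {n} (v : Vec A n) → (∀ i → lookup v i ∈ xs) → v ∈ vectors xs n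
  ∈-vectors []      _   = here refl
  ∈-vectors (a ∷ v) v∈ =
    ∈-concatMap⁺ _ (Any.map (λ { refl → ∈-map⁺ (a ∷_) (∈-vectors v (v∈ ∘ suc)) }) (v∈ zero))

record EnumeratesOnce {A : Set} (_≟_ : DecidableEquality A) (xs : List A) : Set where
  field
    occurs-once : ∀ u → ∑[ a ∈ xs ] ⟦ does (a ≟ u) ⟧ ≡ 1

open EnumeratesOnce

module _ {A : Set} {_≟_ : DecidableEquality A} {xs : List A} (once : EnumeratesOnce _≟_ xs) where

  vectors-enumeratesOnce : ∀ n → EnumeratesOnce (≡-dec _≟_) (vectors xs n)
  vectors-enumeratesOnce n .occurs-once = occurs-once′ n
    where
    occurs-once′ : ∀ n (u : Vec A n) → ∑[ v ∈ vectors xs n ] ⟦ does (≡-dec _≟_ v u) ⟧ ≡ 1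
    occurs-once′ zero    []      = refl
    occurs-once′ (suc n) (b ∷ u) = begin
      ∑[ v ∈ vectors xs (suc n) ] ⟦ does (≡-dec _≟_ v (b ∷ u)) ⟧
        ≡⟨ ∑-vectors xs n _ ⟩
      ∑[ a ∈ xs ] ∑[ v ∈ vectors xs n ] ⟦ does (a ≟ b) ∧ does (≡-dec _≟_ v u) ⟧
        ≡⟨ ∑-cong xs (λ a → trans (∑-cong (vectors xs n) (λ v → ⟦∧⟧ (does (a ≟ b)) _))
                                   (∑-*ˡ (vectors xs n) ⟦ does (a ≟ b) ⟧ _)) ⟩
      ∑[ a ∈ xs ] ⟦ does (a ≟ b) ⟧ * (∑[ v ∈ vectors xs n ] ⟦ does (≡-dec _≟_ v u) ⟧)
        ≡⟨ ∑-cong xs (λ a → trans (cong (⟦ does (a ≟ b) ⟧ *_) (occurs-once′ n u)) (*-identityʳ _)) ⟩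
      ∑[ a ∈ xs ] ⟦ does (a ≟ b) ⟧
        ≡⟨ occurs-once once b ⟩
      1 ∎
      where open ≡-Reasoning

  ∑-partition : ∀ {B : Set} (ys : List B) (s : B → A) g →
                ∑ ys g ≡ ∑[ a ∈ xs ] ∑[ y ∈ ys ] ⟦ does (a ≟ s y) ⟧ * g y
  ∑-partition ys s g = trans (∑-cong ys split) (∑-swap ys xs _)
    where
    split : ∀ y → g y ≡ ∑[ a ∈ xs ] ⟦ does (a ≟ s y) ⟧ * g y
    split y = sym (trans (∑-*ʳ xs (g y) _) (trans (cong (_* g y) (occurs-once once (s y))) (*-identityˡ (g y))))

  ∑-resample : ∀ x₀ {n} (y : Fin n) (f : Vec A n → ℕ) →
               ∑ (vectors xs n) f ≡
               ∑[ V ∈ vectors xs n ] ⟦ does (lookup V y ≟ x₀) ⟧ * (∑[ a ∈ xs ] f (V [ y ]≔ a))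
  ∑-resample x₀ {suc n} zero f = sym (begin
    ∑[ V ∈ vectors xs (suc n) ] ⟦ does (lookup V zero ≟ x₀) ⟧ * (∑[ a ∈ xs ] f (V [ zero ]≔ a))
      ≡⟨ ∑-vectors xs n _ ⟩
    ∑[ b ∈ xs ] ∑[ V ∈ vectors xs n ] ⟦ does (b ≟ x₀) ⟧ * (∑[ a ∈ xs ] f (a ∷ V))
      ≡⟨ ∑-cong xs (λ b → ∑-*ˡ (vectors xs n) ⟦ does (b ≟ x₀) ⟧ _) ⟩
    ∑[ b ∈ xs ] ⟦ does (b ≟ x₀) ⟧ * S
      ≡⟨ ∑-*ʳ xs S _ ⟩
    (∑[ b ∈ xs ] ⟦ does (b ≟ x₀) ⟧) * S
      ≡⟨ trans (cong (_* S) (occurs-once once x₀)) (*-identityˡ S) ⟩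
    S
      ≡⟨ ∑-swap (vectors xs n) xs _ ⟩
    ∑[ a ∈ xs ] ∑[ V ∈ vectors xs n ] f (a ∷ V)
      ≡⟨ sym (∑-vectors xs n f) ⟩
    ∑ (vectors xs (suc n)) f ∎)
    where
    open ≡-Reasoning
    S : ℕ
    S = ∑[ V ∈ vectors xs n ] ∑[ a ∈ xs ] f (a ∷ V)
  ∑-resample x₀ {suc n} (suc y) f =
    trans (∑-vectors xs n f)
          (trans (∑-cong xs (λ b → ∑-resample x₀ y (λ V → f (b ∷ V)))) (sym (∑-vectors xs n _)))

  ∑-resample₂ : ∀ x₀ {n} {y z : Fin n} → y ≢ z → (f : Vec A n → ℕ) →
    ∑ (vectors xs n) f ≡
    ∑[ V ∈ vectors xs n ] ⟦ does (lookup V z ≟ x₀) ⟧ * (⟦ does (lookup V y ≟ x₀) ⟧ *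
      (∑[ b ∈ xs ] ∑[ a ∈ xs ] f ((V [ z ]≔ b) [ y ]≔ a)))
  ∑-resample₂ x₀ {n} {y} {z} y≢z f =
    trans (∑-resample x₀ y f) (trans (∑-resample x₀ z _) (∑-cong (vectors xs n) λ V →
      cong (⟦ does (lookup V z ≟ x₀) ⟧ *_) (trans
        (∑-cong xs (λ b → cong (λ u → ⟦ does (u ≟ x₀) ⟧ * (∑[ a ∈ xs ] f ((V [ z ]≔ b) [ y ]≔ a)))
                                (lookup∘update′ y≢z V b)))
        (∑-*ˡ xs ⟦ does (lookup V y ≟ x₀) ⟧ _))))

𝔹 : List Bool
𝔹 = false ∷ true ∷ []

𝔹^_ : (m : ℕ) → List (Vec Bool m)
𝔹^ m = vectors 𝔹 m

_≟ᵛ_ : ∀ {m} → DecidableEquality (Vec Bool m)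
_≟ᵛ_ = ≡-dec _≟ᴮ_

𝔹^-enumeratesOnce : ∀ m → EnumeratesOnce _≟ᵛ_ (𝔹^ m)
𝔹^-enumeratesOnce = vectors-enumeratesOnce (record { occurs-once = λ { false → refl ; true → refl } })

∑-𝔹^-suc : ∀ m (f : Vec Bool (suc m) → ℕ) →
           ∑ (𝔹^ suc m) f ≡ (∑[ v ∈ 𝔹^ m ] f (false ∷ v)) + (∑[ v ∈ 𝔹^ m ] f (true ∷ v))
∑-𝔹^-suc m f = trans (∑-vectors 𝔹 m f) (cong ((∑[ v ∈ 𝔹^ m ] f (false ∷ v)) +_) (+-identityʳ _))

∑-𝔹^-const : ∀ m k → ∑[ v ∈ 𝔹^ m ] k ≡ k * 2 ^ m
∑-𝔹^-const zero    k = trans (+-identityʳ k) (sym (*-identityʳ k))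
∑-𝔹^-const (suc m) k = trans (∑-𝔹^-suc m (λ _ → k))
  (trans (cong₂ _+_ (∑-𝔹^-const m k) (∑-𝔹^-const m k)) (doubling k (2 ^ m)))
  where
  doubling : ∀ k x → k * x + k * x ≡ k * (2 * x)
  doubling = solve-∀

∣_∣ : ∀ {m} → (Vec Bool m → Bool) → ℕ
∣_∣ {m} P = ∑[ v ∈ 𝔹^ m ] ⟦ P v ⟧

∣full∣ : ∀ m → ∣ (λ (_ : Vec Bool m) → true) ∣ ≡ 2 ^ m
∣full∣ m = trans (∑-𝔹^-const m 1) (*-identityˡ (2 ^ m))

∣∣-split : ∀ {m} (P q : Vec Bool m → Bool) →
           ∣ P ∣ ≡ ∣ (λ v → P v ∧ q v) ∣ + ∣ (λ v → P v ∧ not (q v)) ∣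
∣∣-split {m} P q = trans (∑-cong (𝔹^ m) (λ v → split (P v) (q v))) (∑-distrib-+ (𝔹^ m) _ _)
  where
  split : ∀ a b → ⟦ a ⟧ ≡ ⟦ a ∧ b ⟧ + ⟦ a ∧ not b ⟧
  split true  true  = refl
  split true  false = refl
  split false _     = refl

_⊕_ : ∀ {m} → Vec Bool m → Vec Bool m → Vec Bool m
_⊕_ = zipWith _xor_

infix 7 _·_

_·_ : ∀ {m} → Vec Bool m → Vec Bool m → Bool
[]      · []      = false
(a ∷ u) · (b ∷ v) = (a ∧ b) xor (u · v)

0⃗ : ∀ {m} → Vec Bool m
0⃗ {m} = replicate m false

·-comm : ∀ {m} (u v : Vec Bool m) → u · v ≡ v · u
·-comm []      []      = refl
·-comm (a ∷ u) (b ∷ v) = cong₂ _xor_ (∧-comm a b) (·-comm u v)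

·-zeroˡ : ∀ {m} (u : Vec Bool m) → 0⃗ · u ≡ false
·-zeroˡ []      = refl
·-zeroˡ (_ ∷ u) = ·-zeroˡ u

·-zeroʳ : ∀ {m} (u : Vec Bool m) → u · 0⃗ ≡ false
·-zeroʳ u = trans (·-comm u 0⃗) (·-zeroˡ u)

·-distribʳ-⊕ : ∀ {m} (u v w : Vec Bool m) → (u ⊕ v) · w ≡ (u · w) xor (v · w)
·-distribʳ-⊕ []      []      []      = refl
·-distribʳ-⊕ (a ∷ u) (b ∷ v) (c ∷ w) =
  trans (cong (((a xor b) ∧ c) xor_) (·-distribʳ-⊕ u v w)) (regroup a b c (u · w) (v · w))
  where
  open xor-∧-Solver
  regroup : ∀ a b c x y → ((a xor b) ∧ c) xor (x xor y) ≡ ((a ∧ c) xor x) xor ((b ∧ c) xor y)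
  regroup = solve 5 (λ a b c x y → ((a :+ b) :* c) :+ (x :+ y) := ((a :* c) :+ x) :+ ((b :* c) :+ y)) refl

∑-translate : ∀ m (t : Vec Bool m) (f : Vec Bool m → ℕ) → ∑[ v ∈ 𝔹^ m ] f (v ⊕ t) ≡ ∑ (𝔹^ m) f
∑-translate zero    []        f = refl
∑-translate (suc m) (false ∷ t) f = begin
  ∑[ v ∈ 𝔹^ suc m ] f (v ⊕ (false ∷ t))
    ≡⟨ ∑-𝔹^-suc m _ ⟩
  (∑[ v ∈ 𝔹^ m ] f (false ∷ (v ⊕ t))) + (∑[ v ∈ 𝔹^ m ] f (true ∷ (v ⊕ t)))
    ≡⟨ cong₂ _+_ (∑-translate m t _) (∑-translate m t _) ⟩
  (∑[ v ∈ 𝔹^ m ] f (false ∷ v)) + (∑[ v ∈ 𝔹^ m ] f (true ∷ v))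
    ≡⟨ sym (∑-𝔹^-suc m f) ⟩
  ∑ (𝔹^ suc m) f ∎
  where open ≡-Reasoning
∑-translate (suc m) (true ∷ t) f = begin
  ∑[ v ∈ 𝔹^ suc m ] f (v ⊕ (true ∷ t))
    ≡⟨ ∑-𝔹^-suc m _ ⟩
  (∑[ v ∈ 𝔹^ m ] f (true ∷ (v ⊕ t))) + (∑[ v ∈ 𝔹^ m ] f (false ∷ (v ⊕ t)))
    ≡⟨ cong₂ _+_ (∑-translate m t _) (∑-translate m t _) ⟩
  (∑[ v ∈ 𝔹^ m ] f (true ∷ v)) + (∑[ v ∈ 𝔹^ m ] f (false ∷ v))
    ≡⟨ +-comm (∑[ v ∈ 𝔹^ m ] f (true ∷ v)) _ ⟩
  (∑[ v ∈ 𝔹^ m ] f (false ∷ v)) + (∑[ v ∈ 𝔹^ m ] f (true ∷ v))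
    ≡⟨ sym (∑-𝔹^-suc m f) ⟩
  ∑ (𝔹^ suc m) f ∎
  where open ≡-Reasoning

⊕-Closed : ∀ {m} → (Vec Bool m → Bool) → Set
⊕-Closed Q = ∀ u v → Q v ≡ true → Q (u ⊕ v) ≡ Q u

_ᗮ : ∀ {m} → (Vec Bool m → Bool) → Vec Bool m → Bool
(Q ᗮ) w = ∣ (λ v → Q v ∧ v · w) ∣ ≡ᵇ 0

module _ {m} {Q : Vec Bool m → Bool} (closed : ⊕-Closed Q) (w : Vec Bool m) where

  -- Translating by an element t of Q with t · w = 1 swaps the two halves.
  ∣orth∣≡∣non-orth∣ : ∀ t → Q t ≡ true → t · w ≡ true →
                      ∣ (λ v → Q v ∧ not (v · w)) ∣ ≡ ∣ (λ v → Q v ∧ v · w) ∣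
  ∣orth∣≡∣non-orth∣ t Qt t·w = sym (trans (sym (∑-translate m t _)) (∑-cong (𝔹^ m) swap))
    where
    swap : ∀ v → ⟦ Q (v ⊕ t) ∧ (v ⊕ t) · w ⟧ ≡ ⟦ Q v ∧ not (v · w) ⟧
    swap v rewrite closed v t Qt | ·-distribʳ-⊕ v t w | t·w =
      cong (λ b → ⟦ Q v ∧ b ⟧) (trans (xor-comm (v · w) true) (true-xor (v · w)))

  ∣∣-halving : 2 * ∣ (λ v → Q v ∧ not (v · w)) ∣ ≡ ∣ Q ∣ + ∣ Q ∣ * ⟦ (Q ᗮ) w ⟧
  ∣∣-halving = by-cases _ refl
    where
    open ≡-Reasoning
    A B : ℕ
    A = ∣ (λ v → Q v ∧ not (v · w)) ∣
    B = ∣ (λ v → Q v ∧ v · w) ∣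
    by-cases : ∀ k → B ≡ k → 2 * A ≡ ∣ Q ∣ + ∣ Q ∣ * ⟦ k ≡ᵇ 0 ⟧
    by-cases zero B≡0 = begin
      2 * A          ≡⟨ doubling A ⟩
      A + A * 1      ≡⟨ cong (λ x → x + x * 1) (trans (cong (_+ A) (sym B≡0)) (sym (∣∣-split Q (_· w)))) ⟩
      ∣ Q ∣ + ∣ Q ∣ * 1 ∎
      where
      doubling : ∀ x → 2 * x ≡ x + x * 1
      doubling = solve-∀
    by-cases (suc k) B≡suc = begin
      2 * A          ≡⟨ cong (A +_) (+-identityʳ A) ⟩
      A + A          ≡⟨ cong (A +_) balanced ⟩
      A + B          ≡⟨ +-comm A B ⟩
      B + A          ≡⟨ sym (∣∣-split Q (_· w)) ⟩
      ∣ Q ∣          ≡⟨ sym (trans (cong (∣ Q ∣ +_) (*-zeroʳ ∣ Q ∣)) (+-identityʳ ∣ Q ∣)) ⟩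
      ∣ Q ∣ + ∣ Q ∣ * 0 ∎
      where
      witness : ∃[ t ] 0 < ⟦ Q t ∧ t · w ⟧
      witness = ∑-positive (𝔹^ m) _ (subst (0 <_) (sym B≡suc) (s≤s z≤n))
      t : Vec Bool m
      t = proj₁ witness
      Qt∧t·w : Q t ∧ t · w ≡ true
      Qt∧t·w = ⟦⟧-positive (proj₂ witness)
      balanced : A ≡ B
      balanced = ∣orth∣≡∣non-orth∣ t (∧-conicalˡ _ _ Qt∧t·w) (∧-conicalʳ _ _ Qt∧t·w)

∣∣≤2∣orth∣ : ∀ {m} {P : Vec Bool m → Bool} → ⊕-Closed P → ∀ w →
             ∣ P ∣ ≤ 2 * ∣ (λ v → P v ∧ not (v · w)) ∣
∣∣≤2∣orth∣ closed w = ≤-trans (m≤m+n _ _) (≤-reflexive (sym (∣∣-halving closed w)))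

orthogonalTo : ∀ {m} → List (Vec Bool m) → Vec Bool m → Bool
orthogonalTo As v = all (λ a → not (v · a)) As

orthogonalTo-closed : ∀ {m} (As : List (Vec Bool m)) → ⊕-Closed (orthogonalTo As)
orthogonalTo-closed []       u v _  = refl
orthogonalTo-closed (a ∷ As) u v ok = cong₂ _∧_ first (orthogonalTo-closed As u v (∧-conicalʳ _ _ ok))
  where
  v·a≡false : v · a ≡ false
  v·a≡false = not-injective (∧-conicalˡ _ _ ok)
  first : not ((u ⊕ v) · a) ≡ not (u · a)
  first = cong not (trans (·-distribʳ-⊕ u v a) (trans (cong ((u · a) xor_) v·a≡false) (xor-identityʳ (u · a))))

∣orthogonalTo∣-≥ : ∀ {m} (As : List (Vec Bool m)) → 2 ^ m ≤ 2 ^ length As * ∣ orthogonalTo As ∣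
∣orthogonalTo∣-≥ {m} [] = ≤-reflexive (sym (trans (+-identityʳ _) (∣full∣ m)))
∣orthogonalTo∣-≥ {m} (a ∷ As) = begin
  2 ^ m                      ≤⟨ ∣orthogonalTo∣-≥ As ⟩
  2 ^ L * ∣ P ∣              ≤⟨ *-monoʳ-≤ (2 ^ L) (∣∣≤2∣orth∣ (orthogonalTo-closed As) a) ⟩
  2 ^ L * (2 * ∣ (λ v → P v ∧ not (v · a)) ∣)
    ≡⟨ cong (λ x → 2 ^ L * (2 * x)) (∑-cong (𝔹^ m) (λ v → cong ⟦_⟧ (∧-comm (P v) _))) ⟩
  2 ^ L * (2 * ∣ orthogonalTo (a ∷ As) ∣) ≡⟨ regroup (2 ^ L) _ ⟩
  2 ^ suc L * ∣ orthogonalTo (a ∷ As) ∣ ∎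
  where
  open ≤-Reasoning
  L : ℕ
  L = length As
  P : Vec Bool m → Bool
  P = orthogonalTo As
  regroup : ∀ x y → x * (2 * y) ≡ 2 * x * y
  regroup = solve-∀

2∣orth∣≤ : ∀ {m} (w : Vec Bool m) →
           2 * ∣ (λ v → not (v · w)) ∣ ≤ 2 ^ m + 2 ^ m * ⟦ does (w ≟ᵛ 0⃗) ⟧
2∣orth∣≤ {zero}  []         = ≤-refl
2∣orth∣≤ {suc m} (true ∷ w) = ≤-reflexive (begin
  2 * ∣ (λ v → not (v · (true ∷ w))) ∣
    ≡⟨ cong (2 *_) (∑-𝔹^-suc m _) ⟩
  2 * (∣ (λ v → not (v · w)) ∣ + ∣ (λ v → not (not (v · w))) ∣)
    ≡⟨ cong (2 *_) (sym (∣∣-split (λ _ → true) (λ v → not (v · w)))) ⟩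
  2 * ∣ (λ (_ : Vec Bool m) → true) ∣
    ≡⟨ cong (2 *_) (∣full∣ m) ⟩
  2 ^ suc m
    ≡⟨ sym (trans (cong (2 ^ suc m +_) (*-zeroʳ (2 ^ suc m))) (+-identityʳ _)) ⟩
  2 ^ suc m + 2 ^ suc m * 0 ∎)
  where open ≡-Reasoning
2∣orth∣≤ {suc m} (false ∷ w) = begin
  2 * ∣ (λ v → not (v · (false ∷ w))) ∣
    ≡⟨ cong (2 *_) (∑-𝔹^-suc m _) ⟩
  2 * (X + X)                         ≡⟨ regroup X ⟩
  2 * X + 2 * X                       ≤⟨ +-mono-≤ (2∣orth∣≤ w) (2∣orth∣≤ w) ⟩
  (x + x * e) + (x + x * e)           ≡⟨ regroup′ x e ⟩
  2 ^ suc m + 2 ^ suc m * e ∎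
  where
  open ≤-Reasoning
  X x e : ℕ
  X = ∣ (λ v → not (v · w)) ∣
  x = 2 ^ m
  e = ⟦ does (w ≟ᵛ 0⃗) ⟧
  regroup : ∀ X → 2 * (X + X) ≡ 2 * X + 2 * X
  regroup = solve-∀
  regroup′ : ∀ x e → (x + x * e) + (x + x * e) ≡ 2 * x + 2 * x * e
  regroup′ = solve-∀

∣∣*∣ᗮ∣≤2^ : ∀ {m} {Q : Vec Bool m → Bool} → ⊕-Closed Q → ∣ Q ∣ * ∣ Q ᗮ ∣ ≤ 2 ^ m
∣∣*∣ᗮ∣≤2^ {m} {Q} closed = +-cancelˡ-≤ (∣ Q ∣ * 2 ^ m) _ _ (begin
  ∣ Q ∣ * 2 ^ m + ∣ Q ∣ * ∣ Q ᗮ ∣ ≡⟨ sym counted-by-w ⟩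
  2 * N                           ≤⟨ counted-by-v ⟩
  ∣ Q ∣ * 2 ^ m + 2 ^ m           ∎)
  where
  open ≤-Reasoning
  N : ℕ
  N = ∑[ w ∈ 𝔹^ m ] ∣ (λ v → Q v ∧ not (v · w)) ∣
  X : Vec Bool m → ℕ
  X v = ∣ (λ w → not (w · v)) ∣
  counted-by-w : 2 * N ≡ ∣ Q ∣ * 2 ^ m + ∣ Q ∣ * ∣ Q ᗮ ∣
  counted-by-w = begin-equality
    2 * N
      ≡⟨ sym (∑-*ˡ (𝔹^ m) 2 _) ⟩
    ∑[ w ∈ 𝔹^ m ] 2 * ∣ (λ v → Q v ∧ not (v · w)) ∣
      ≡⟨ ∑-cong (𝔹^ m) (∣∣-halving closed) ⟩
    ∑[ w ∈ 𝔹^ m ] ∣ Q ∣ + ∣ Q ∣ * ⟦ (Q ᗮ) w ⟧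
      ≡⟨ ∑-distrib-+ (𝔹^ m) _ _ ⟩
    (∑[ w ∈ 𝔹^ m ] ∣ Q ∣) + (∑[ w ∈ 𝔹^ m ] ∣ Q ∣ * ⟦ (Q ᗮ) w ⟧)
      ≡⟨ cong₂ _+_ (∑-𝔹^-const m ∣ Q ∣) (∑-*ˡ (𝔹^ m) ∣ Q ∣ _) ⟩
    ∣ Q ∣ * 2 ^ m + ∣ Q ∣ * ∣ Q ᗮ ∣ ∎
  regroup : ∀ v → ∑[ w ∈ 𝔹^ m ] ⟦ Q v ∧ not (v · w) ⟧ ≡ ⟦ Q v ⟧ * X v
  regroup v = trans (∑-cong (𝔹^ m) λ w →
                      trans (cong (λ b → ⟦ Q v ∧ not b ⟧) (·-comm v w)) (⟦∧⟧ (Q v) _))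
                    (∑-*ˡ (𝔹^ m) ⟦ Q v ⟧ _)
  counted-by-v : 2 * N ≤ ∣ Q ∣ * 2 ^ m + 2 ^ m
  counted-by-v = begin
    2 * N
      ≡⟨ cong (2 *_) (trans (∑-swap (𝔹^ m) (𝔹^ m) _) (∑-cong (𝔹^ m) regroup)) ⟩
    2 * (∑[ v ∈ 𝔹^ m ] ⟦ Q v ⟧ * X v)
      ≡⟨ sym (∑-*ˡ (𝔹^ m) 2 _) ⟩
    ∑[ v ∈ 𝔹^ m ] 2 * (⟦ Q v ⟧ * X v)
      ≡⟨ ∑-cong (𝔹^ m) (λ v → *-CS.x∙yz≈y∙xz 2 ⟦ Q v ⟧ (X v)) ⟩
    ∑[ v ∈ 𝔹^ m ] ⟦ Q v ⟧ * (2 * X v)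
      ≤⟨ ∑-mono-≤ (𝔹^ m) (λ v → *-monoʳ-≤ ⟦ Q v ⟧ (2∣orth∣≤ v)) ⟩
    ∑[ v ∈ 𝔹^ m ] ⟦ Q v ⟧ * (2 ^ m + 2 ^ m * ⟦ does (v ≟ᵛ 0⃗) ⟧)
      ≤⟨ ∑-mono-≤ (𝔹^ m) (λ v → ⟦⟧*-+-≤ (Q v) (2 ^ m) _) ⟩
    ∑[ v ∈ 𝔹^ m ] ⟦ Q v ⟧ * 2 ^ m + 2 ^ m * ⟦ does (v ≟ᵛ 0⃗) ⟧
      ≡⟨ ∑-distrib-+ (𝔹^ m) _ _ ⟩
    (∑[ v ∈ 𝔹^ m ] ⟦ Q v ⟧ * 2 ^ m) + (∑[ v ∈ 𝔹^ m ] 2 ^ m * ⟦ does (v ≟ᵛ 0⃗) ⟧)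
      ≡⟨ cong₂ _+_ (∑-*ʳ (𝔹^ m) (2 ^ m) _) (∑-*ˡ (𝔹^ m) (2 ^ m) _) ⟩
    ∣ Q ∣ * 2 ^ m + 2 ^ m * (∑[ v ∈ 𝔹^ m ] ⟦ does (v ≟ᵛ 0⃗) ⟧)
      ≡⟨ cong (λ k → ∣ Q ∣ * 2 ^ m + 2 ^ m * k) (occurs-once (𝔹^-enumeratesOnce m) 0⃗) ⟩
    ∣ Q ∣ * 2 ^ m + 2 ^ m * 1
      ≡⟨ cong (∣ Q ∣ * 2 ^ m +_) (*-identityʳ (2 ^ m)) ⟩
    ∣ Q ∣ * 2 ^ m + 2 ^ m ∎

five-eighths : ∀ s {x e} → 2 * s ≤ x + e → 2 * (2 * e) ≤ x → 8 * s ≤ 5 * x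
five-eighths s {x} {e} 2s≤x+e 4e≤x = *-cancelˡ-≤ 2 (begin
  2 * (8 * s)              ≡⟨ e₁ s ⟩
  8 * (2 * s)              ≤⟨ *-monoʳ-≤ 8 2s≤x+e ⟩
  8 * (x + e)              ≡⟨ e₂ x e ⟩
  8 * x + 2 * (2 * (2 * e)) ≤⟨ +-monoʳ-≤ (8 * x) (*-monoʳ-≤ 2 4e≤x) ⟩
  8 * x + 2 * x            ≡⟨ e₃ x ⟩
  2 * (5 * x)              ∎)
  where
  open ≤-Reasoning
  e₁ : ∀ s → 2 * (8 * s) ≡ 8 * (2 * s)
  e₁ = solve-∀
  e₂ : ∀ x e → 8 * (x + e) ≡ 8 * x + 2 * (2 * (2 * e))
  e₂ = solve-∀
  e₃ : ∀ x → 8 * x + 2 * x ≡ 2 * (5 * x)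
  e₃ = solve-∀

orthogonal-pairs-≤ : ∀ {m} (P : Vec Bool m → Bool) {Q : Vec Bool m → Bool} → ⊕-Closed Q →
  2 ^ (2 + m) ≤ ∣ P ∣ * ∣ Q ∣ →
  8 * (∑[ a ∈ 𝔹^ m ] ∑[ b ∈ 𝔹^ m ] ⟦ P a ∧ (Q b ∧ not (b · a)) ⟧) ≤ 5 * (∣ P ∣ * ∣ Q ∣)
orthogonal-pairs-≤ {m} P {Q} closed large = five-eighths S twice-bound large
  where
  open ≤-Reasoning
  S : ℕ
  S = ∑[ a ∈ 𝔹^ m ] ∑[ b ∈ 𝔹^ m ] ⟦ P a ∧ (Q b ∧ not (b · a)) ⟧
  Y : Vec Bool m → ℕ
  Y a = ∣ (λ b → Q b ∧ not (b · a)) ∣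
  twice-bound : 2 * S ≤ ∣ P ∣ * ∣ Q ∣ + 2 ^ m
  twice-bound = begin
    2 * (∑[ a ∈ 𝔹^ m ] ∑[ b ∈ 𝔹^ m ] ⟦ P a ∧ (Q b ∧ not (b · a)) ⟧)
      ≡⟨ cong (2 *_) (∑-cong (𝔹^ m) λ a →
           trans (∑-cong (𝔹^ m) (λ b → ⟦∧⟧ (P a) _)) (∑-*ˡ (𝔹^ m) ⟦ P a ⟧ _)) ⟩
    2 * (∑[ a ∈ 𝔹^ m ] ⟦ P a ⟧ * Y a)
      ≡⟨ sym (∑-*ˡ (𝔹^ m) 2 _) ⟩
    ∑[ a ∈ 𝔹^ m ] 2 * (⟦ P a ⟧ * Y a)
      ≡⟨ ∑-cong (𝔹^ m) (λ a → trans (*-CS.x∙yz≈y∙xz 2 ⟦ P a ⟧ (Y a))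
                                    (cong (⟦ P a ⟧ *_) (∣∣-halving closed a))) ⟩
    ∑[ a ∈ 𝔹^ m ] ⟦ P a ⟧ * (∣ Q ∣ + ∣ Q ∣ * ⟦ (Q ᗮ) a ⟧)
      ≤⟨ ∑-mono-≤ (𝔹^ m) (λ a → ⟦⟧*-+-≤ (P a) ∣ Q ∣ _) ⟩
    ∑[ a ∈ 𝔹^ m ] ⟦ P a ⟧ * ∣ Q ∣ + ∣ Q ∣ * ⟦ (Q ᗮ) a ⟧
      ≡⟨ trans (∑-distrib-+ (𝔹^ m) _ _)
               (cong₂ _+_ (∑-*ʳ (𝔹^ m) ∣ Q ∣ _) (∑-*ˡ (𝔹^ m) ∣ Q ∣ _)) ⟩
    ∣ P ∣ * ∣ Q ∣ + ∣ Q ∣ * ∣ Q ᗮ ∣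
      ≤⟨ +-monoʳ-≤ (∣ P ∣ * ∣ Q ∣) (∣∣*∣ᗮ∣≤2^ closed) ⟩
    ∣ P ∣ * ∣ Q ∣ + 2 ^ m ∎

8*≤5*-scale : ∀ k {x y} → 8 * x ≤ 5 * y → 8 * (k * x) ≤ 5 * (k * y)
8*≤5*-scale k {x} {y} 8x≤5y = begin
  8 * (k * x) ≡⟨ *-CS.x∙yz≈y∙xz 8 k x ⟩
  k * (8 * x) ≤⟨ *-monoʳ-≤ k 8x≤5y ⟩
  k * (5 * y) ≡⟨ *-CS.x∙yz≈y∙xz k 5 y ⟩
  5 * (k * y) ∎
  where open ≤-Reasoning

all≡true⁻ : ∀ {A : Set} (p : A → Bool) {xs} → all p xs ≡ true → ∀ {x} → x ∈ xs → p x ≡ true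
all≡true⁻ p {_ ∷ _} ok (here refl)  = ∧-conicalˡ _ _ ok
all≡true⁻ p {_ ∷ _} ok (there x∈xs) = all≡true⁻ p (∧-conicalʳ _ _ ok) x∈xs

all≡true⁺ : ∀ {A : Set} (p : A → Bool) {xs} → (∀ {x} → x ∈ xs → p x ≡ true) → all p xs ≡ true
all≡true⁺ p {[]}     ok = refl
all≡true⁺ p {_ ∷ xs} ok = cong₂ _∧_ (ok (here refl)) (all≡true⁺ p (ok ∘ there))

bool-ext : ∀ {a b : Bool} → (a ≡ true → b ≡ true) → (b ≡ true → a ≡ true) → a ≡ b
bool-ext {true}  {b}     a⇒b _   = sym (a⇒b refl)
bool-ext {false} {true}  _   b⇒a = b⇒a refl
bool-ext {false} {false} _   _   = refl

module OrthogonalLabelings {n : ℕ} (G : Graph n) {c : ℕ} where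

  neighbours : Fin n → List (Fin n)
  neighbours u = filterᵇ (adj G u) (allFin n)

  admissibleAt : Vec (Label c) n → Fin n → Label c → Bool
  admissibleAt V y = orthogonalTo (map (lookup V) (neighbours y))

  orthogonal : Vec (Label c) n → Bool
  orthogonal V = all (λ u → admissibleAt V u (lookup V u)) (allFin n)

  adj⇒≢ : ∀ {u v} → adj G u v ≡ true → u ≢ v
  adj⇒≢ {u} uv refl with () ← trans (sym uv) (irrefl G u)

  adj-sym : ∀ {u v} → adj G u v ≡ true → adj G v u ≡ true
  adj-sym {u} {v} uv = trans (Graph.sym G v u) uv

  admissibleAt-elim : ∀ V y a {w} → admissibleAt V y a ≡ true → adj G y w ≡ true → a · lookup V w ≡ false
  admissibleAt-elim V y a {w} ok yw = not-injective (all≡true⁻ _ ok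
    (∈-map⁺ (lookup V) (∈-filter⁺ (T? ∘ adj G y) (∈-allFin w) (Equivalence.from T-≡ yw))))

  admissibleAt-intro : ∀ V y a → (∀ w → adj G y w ≡ true → a · lookup V w ≡ false) → admissibleAt V y a ≡ true
  admissibleAt-intro V y a ok = all≡true⁺ _ orthogonal-to-neighbour
    where
    orthogonal-to-neighbour : ∀ {b} → b ∈ map (lookup V) (neighbours y) → not (a · b) ≡ true
    orthogonal-to-neighbour b∈ with ∈-map⁻ (lookup V) b∈
    ... | w , w∈ , refl = cong not (ok w (Equivalence.to T-≡ (proj₂ (∈-filter⁻ (T? ∘ adj G y) {xs = allFin n} w∈))))

  orthogonal-elim : ∀ V {u v} → orthogonal V ≡ true → adj G u v ≡ true → lookup V u · lookup V v ≡ false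
  orthogonal-elim V {u} ok uv = admissibleAt-elim V u (lookup V u) (all≡true⁻ _ {allFin n} ok (∈-allFin u)) uv

  orthogonal-intro : ∀ V → (∀ u v → adj G u v ≡ true → lookup V u · lookup V v ≡ false) → orthogonal V ≡ true
  orthogonal-intro V ok = all≡true⁺ _ {allFin n} (λ {u} _ → admissibleAt-intro V u (lookup V u) (ok u))

  orthogonal-update : ∀ V y a → lookup V y ≡ 0⃗ → orthogonal (V [ y ]≔ a) ≡ orthogonal V ∧ admissibleAt V y a
  orthogonal-update V y a Vy≡0 = bool-ext (λ ok → cong₂ _∧_ (V-orthogonal ok) (a-admissible ok)) W-orthogonal
    where
    W : Vec (Label c) n
    W = V [ y ]≔ a
    W-y : lookup W y ≡ a
    W-y = lookup∘update y V a
    W-other : ∀ {u} → u ≢ y → lookup W u ≡ lookup V u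
    W-other u≢y = lookup∘update′ u≢y V a
    V-orthogonal : orthogonal W ≡ true → orthogonal V ≡ true
    V-orthogonal ok = orthogonal-intro V edge
      where
      edge : ∀ u v → adj G u v ≡ true → lookup V u · lookup V v ≡ false
      edge u v uv with u ≟ y | v ≟ y
      ... | yes refl | _        = subst (λ x → x · lookup V v ≡ false) (sym Vy≡0) (·-zeroˡ (lookup V v))
      ... | no _     | yes refl = subst (λ x → lookup V u · x ≡ false) (sym Vy≡0) (·-zeroʳ (lookup V u))
      ... | no u≢y   | no v≢y   = subst₂ (λ p q → p · q ≡ false) (W-other u≢y) (W-other v≢y)
                                    (orthogonal-elim W ok uv)
    a-admissible : orthogonal W ≡ true → admissibleAt V y a ≡ true
    a-admissible ok = admissibleAt-intro V y a λ w yw →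
      subst₂ (λ p q → p · q ≡ false) W-y (W-other (adj⇒≢ yw ∘ sym)) (orthogonal-elim W ok yw)
    W-orthogonal : orthogonal V ∧ admissibleAt V y a ≡ true → orthogonal W ≡ true
    W-orthogonal ok = orthogonal-intro W edge
      where
      V-ok : orthogonal V ≡ true
      V-ok = ∧-conicalˡ _ _ ok
      a-ok : admissibleAt V y a ≡ true
      a-ok = ∧-conicalʳ _ _ ok
      edge : ∀ u v → adj G u v ≡ true → lookup W u · lookup W v ≡ false
      edge u v uv with u ≟ y | v ≟ y
      ... | yes refl | _        = subst₂ (λ p q → p · q ≡ false) (sym W-y) (sym (W-other (adj⇒≢ uv ∘ sym)))
                                    (admissibleAt-elim V y a a-ok uv)
      ... | no u≢y   | yes refl = subst₂ (λ p q → p · q ≡ false) (sym (W-other u≢y)) (sym W-y)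
                                    (trans (·-comm (lookup V u) a) (admissibleAt-elim V y a a-ok (adj-sym uv)))
      ... | no u≢y   | no v≢y   = subst₂ (λ p q → p · q ≡ false) (sym (W-other u≢y)) (sym (W-other v≢y))
                                    (orthogonal-elim V V-ok uv)

  admissibleAt-update : ∀ V {y z} b → adj G y z ≡ false → admissibleAt (V [ z ]≔ b) y ≗ admissibleAt V y
  admissibleAt-update V {y} {z} b yz a = bool-ext
    (λ ok → admissibleAt-intro V y a λ w yw →
              trans (cong (a ·_) (sym (unchanged yw))) (admissibleAt-elim (V [ z ]≔ b) y a ok yw))
    (λ ok → admissibleAt-intro (V [ z ]≔ b) y a λ w yw →
              trans (cong (a ·_) (unchanged yw)) (admissibleAt-elim V y a ok yw))
    where
    unchanged : ∀ {w} → adj G y w ≡ true → lookup (V [ z ]≔ b) w ≡ lookup V w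
    unchanged {w} yw = lookup∘update′ (λ { refl → true≢false (trans (sym yw) yz) }) V b
      where
      true≢false : true ≢ false
      true≢false ()

  orthogonal-update₂ : ∀ V {y z} a b → y ≢ z → adj G y z ≡ false → lookup V y ≡ 0⃗ → lookup V z ≡ 0⃗ →
    orthogonal ((V [ z ]≔ b) [ y ]≔ a) ≡ (orthogonal V ∧ admissibleAt V z b) ∧ admissibleAt V y a
  orthogonal-update₂ V {y} {z} a b y≢z yz Vy≡0 Vz≡0 =
    trans (orthogonal-update (V [ z ]≔ b) y a (trans (lookup∘update′ y≢z V b) Vy≡0))
          (cong₂ _∧_ (orthogonal-update V z b Vz≡0) (admissibleAt-update V b yz a))

  admissibleAt-closed : ∀ V y → ⊕-Closed (admissibleAt V y)
  admissibleAt-closed V y = orthogonalTo-closed (map (lookup V) (neighbours y))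

  ∣admissibleAt∣-≥ : ∀ V y → 2 ^ c ≤ 2 ^ degree G y * ∣ admissibleAt V y ∣
  ∣admissibleAt∣-≥ V y = subst (λ k → 2 ^ c ≤ 2 ^ k * ∣ admissibleAt V y ∣)
                               (length-map (lookup V) (neighbours y))
                               (∣orthogonalTo∣-≥ (map (lookup V) (neighbours y)))

  labelings : List (Vec (Label c) n)
  labelings = vectors (𝔹^ c) n

  orthogonalLabelings : List (Vec (Label c) n)
  orthogonalLabelings = filterᵇ orthogonal labelings

  zeroLabeling : Vec (Label c) n
  zeroLabeling = replicate n 0⃗

  zeroLabeling-orthogonal : orthogonal zeroLabeling ≡ true
  zeroLabeling-orthogonal = orthogonal-intro zeroLabeling λ u v _ →
    subst (λ x → x · lookup zeroLabeling v ≡ false) (sym (lookup-replicate u 0⃗)) (·-zeroˡ (lookup zeroLabeling v))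

  zeroLabeling∈orthogonalLabelings : zeroLabeling ∈ orthogonalLabelings
  zeroLabeling∈orthogonalLabelings =
    ∈-filter⁺ (T? ∘ orthogonal) zeroLabeling∈labelings (Equivalence.from T-≡ zeroLabeling-orthogonal)
    where
    zeroLabeling∈labelings : zeroLabeling ∈ labelings
    zeroLabeling∈labelings = ∈-vectors zeroLabeling λ i → subst (_∈ 𝔹^ c) (sym (lookup-replicate i 0⃗))
      (∈-vectors 0⃗ (λ j → subst (_∈ 𝔹) (sym (lookup-replicate j false)) (here refl)))

  ∈orthogonalLabelings⇒orthogonal : ∀ {V} → V ∈ orthogonalLabelings → orthogonal V ≡ true
  ∈orthogonalLabelings⇒orthogonal V∈ = Equivalence.to T-≡ (proj₂ (∈-filter⁻ (T? ∘ orthogonal) {xs = labelings} V∈))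

forges : ∀ {n c} → (Label c → Label c → Bool) → Graph n → Labeling n c → (Fin n → Bool) →
         List (Fin n) × (Fin n × Fin n) → Bool
forges D G ℓ F (qs , (y , z)) =
  not ⌊ y ≟ z ⌋ ∧ not (F y ∨ F z ∨ any (λ x → ⌊ x ≟ y ⌋ ∨ ⌊ x ≟ z ⌋) qs) ∧
  not (adj G y z) ∧ D (ℓ y) (ℓ z)

-- F marks the vertices queried on the way to the current node of the adversary.
winsAvoiding : ∀ {n c k} → (Label c → Label c → Bool) → Graph n → (Fin n → Bool) →
               Adversary n c k → Labeling n c → Bool
winsAvoiding D G F (guess y z) ℓ = forges D G ℓ F ([] , (y , z))
winsAvoiding D G F (query x f) ℓ = winsAvoiding D G (λ v → F v ∨ ⌊ x ≟ v ⌋) (f (ℓ x)) ℓ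

winsAvoiding≡forges : ∀ {n c k} D G F (A : Adversary n c k) ℓ → winsAvoiding D G F A ℓ ≡ forges D G ℓ F (run A ℓ)
winsAvoiding≡forges D G F (guess y z) ℓ = refl
winsAvoiding≡forges D G F (query x f) ℓ
  with run (f (ℓ x)) ℓ | winsAvoiding≡forges D G (λ v → F v ∨ ⌊ x ≟ v ⌋) (f (ℓ x)) ℓ
... | qs , (y , z) | ih = trans ih (cong (λ b → not ⌊ y ≟ z ⌋ ∧ not b ∧ not (adj G y z) ∧ D (ℓ y) (ℓ z))
                                         (shuffle (F y) ⌊ x ≟ y ⌋ (F z) ⌊ x ≟ z ⌋ _))
  where
  open ∨-∧-Solver
  shuffle : ∀ a b c d r → (a ∨ b) ∨ ((c ∨ d) ∨ r) ≡ a ∨ (c ∨ ((b ∨ d) ∨ r))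
  shuffle = solve 5 (λ a b c d r → (a :+ b) :+ ((c :+ d) :+ r) := a :+ (c :+ ((b :+ d) :+ r))) refl

wins≡winsAvoiding : ∀ {n c k} D G (A : Adversary n c k) ℓ → wins D G ℓ A ≡ winsAvoiding D G (λ _ → false) A ℓ
wins≡winsAvoiding D G A ℓ = trans (wins≡forges) (sym (winsAvoiding≡forges D G (λ _ → false) A ℓ))
  where
  wins≡forges : wins D G ℓ A ≡ forges D G ℓ (λ _ → false) (run A ℓ)
  wins≡forges with run A ℓ
  ... | qs , (y , z) = refl

infix 4 _⊥?_

_⊥?_ : ∀ {c} → Label c → Label c → Bool
a ⊥? b = not (a · b)

-- 2d + 2, written so that 2 + labelLength d reduces to (d + 2) + (d + 2).
labelLength : ℕ → ℕ
labelLength d = d + suc (suc d)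

⟦⟧-regroup : ∀ o q p d m → ⟦ (o ∧ q) ∧ p ⟧ * (⟦ d ⟧ * m) ≡ (⟦ o ⟧ * m) * ⟦ p ∧ (q ∧ d) ⟧
⟦⟧-regroup o q p d m rewrite ⟦∧⟧ (o ∧ q) p | ⟦∧⟧ o q | ⟦∧⟧ p (q ∧ d) | ⟦∧⟧ q d =
  ring ⟦ o ⟧ ⟦ q ⟧ ⟦ p ⟧ ⟦ d ⟧ m
  where
  ring : ∀ o q p d m → o * q * p * (d * m) ≡ o * m * (p * (q * d))
  ring = solve-∀

⟦⟧-regroup′ : ∀ o q p m → ⟦ (o ∧ q) ∧ p ⟧ * m ≡ (⟦ o ⟧ * m) * (⟦ p ⟧ * ⟦ q ⟧)
⟦⟧-regroup′ o q p m rewrite ⟦∧⟧ (o ∧ q) p | ⟦∧⟧ o q = ring ⟦ o ⟧ ⟦ q ⟧ ⟦ p ⟧ m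
  where
  ring : ∀ o q p m → o * q * p * m ≡ o * m * (p * q)
  ring = solve-∀

module Forgery {n : ℕ} (G : Graph n) {d : ℕ} (maxDegree : MaxDegree≤ d G) where

  c : ℕ
  c = labelLength d

  open OrthogonalLabelings G {c}

  ∣admissibleAt∣-large : ∀ V y → 2 ^ suc (suc d) ≤ ∣ admissibleAt V y ∣
  ∣admissibleAt∣-large V y = *-cancelˡ-≤ (2 ^ d) {{m^n≢0 2 d}} (begin
    2 ^ d * 2 ^ suc (suc d)           ≡⟨ sym (^-distribˡ-+-* 2 d (suc (suc d))) ⟩
    2 ^ c                             ≤⟨ ∣admissibleAt∣-≥ V y ⟩
    2 ^ degree G y * ∣ admissibleAt V y ∣ ≤⟨ *-monoˡ-≤ ∣ admissibleAt V y ∣ (^-monoʳ-≤ 2 (maxDegree y)) ⟩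
    2 ^ d * ∣ admissibleAt V y ∣ ∎)
    where open ≤-Reasoning

  admissible-pairs-large : ∀ V y z → 2 ^ (2 + c) ≤ ∣ admissibleAt V y ∣ * ∣ admissibleAt V z ∣
  admissible-pairs-large V y z =
    subst (_≤ ∣ admissibleAt V y ∣ * ∣ admissibleAt V z ∣) (sym (^-distribˡ-+-* 2 (suc (suc d)) (suc (suc d))))
          (*-mono-≤ (∣admissibleAt∣-large V y) (∣admissibleAt∣-large V z))

  Ω : List (Vec (Label c) n)
  Ω = orthogonalLabelings

  pair-bound : ∀ {y z} → y ≢ z → adj G y z ≡ false → (μ : Vec (Label c) n → ℕ) →
    (∀ V a → μ (V [ y ]≔ a) ≡ μ V) → (∀ V b → μ (V [ z ]≔ b) ≡ μ V) →
    8 * (∑[ V ∈ Ω ] ⟦ lookup V y ⊥? lookup V z ⟧ * μ V) ≤ 5 * (∑[ V ∈ Ω ] μ V)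
  pair-bound {y} {z} y≢z yz μ μ-y μ-z = begin
    8 * (∑[ V ∈ Ω ] g V)                                  ≡⟨ cong (8 *_) (resampled g) ⟩
    8 * (∑[ V ∈ labelings ] ez V * (ey V * fibre g V))    ≡⟨ sym (∑-*ˡ labelings 8 _) ⟩
    ∑[ V ∈ labelings ] 8 * (ez V * (ey V * fibre g V))    ≤⟨ ∑-mono-≤ labelings per-labeling ⟩
    ∑[ V ∈ labelings ] 5 * (ez V * (ey V * fibre μ V))    ≡⟨ ∑-*ˡ labelings 5 _ ⟩
    5 * (∑[ V ∈ labelings ] ez V * (ey V * fibre μ V))    ≡⟨ cong (5 *_) (sym (resampled μ)) ⟩
    5 * (∑[ V ∈ Ω ] μ V) ∎
    where
    open ≤-Reasoning
    g : Vec (Label c) n → ℕ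
    g V = ⟦ lookup V y ⊥? lookup V z ⟧ * μ V
    ey ez : Vec (Label c) n → ℕ
    ey V = ⟦ does (lookup V y ≟ᵛ 0⃗) ⟧
    ez V = ⟦ does (lookup V z ≟ᵛ 0⃗) ⟧
    W : Vec (Label c) n → Label c → Label c → Vec (Label c) n
    W V a b = (V [ z ]≔ b) [ y ]≔ a
    fibre : (Vec (Label c) n → ℕ) → Vec (Label c) n → ℕ
    fibre h V = ∑[ b ∈ 𝔹^ c ] ∑[ a ∈ 𝔹^ c ] ⟦ orthogonal (W V a b) ⟧ * h (W V a b)
    resampled : ∀ h → ∑[ V ∈ Ω ] h V ≡ ∑[ V ∈ labelings ] ez V * (ey V * fibre h V)
    resampled h = trans (∑-filterᵇ orthogonal labelings h)
                        (∑-resample₂ (𝔹^-enumeratesOnce c) 0⃗ y≢z (λ V → ⟦ orthogonal V ⟧ * h V))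

    fibre-bound : ∀ V → lookup V y ≡ 0⃗ → lookup V z ≡ 0⃗ → 8 * fibre g V ≤ 5 * fibre μ V
    fibre-bound V Vy≡0 Vz≡0 = subst₂ (λ s t → 8 * s ≤ 5 * t) (sym fibre-g) (sym fibre-μ)
      (8*≤5*-scale C (orthogonal-pairs-≤ P (admissibleAt-closed V z) (admissible-pairs-large V y z)))
      where
      P Q : Label c → Bool
      P = admissibleAt V y
      Q = admissibleAt V z
      C : ℕ
      C = ⟦ orthogonal V ⟧ * μ V
      orthogonal-W : ∀ a b → orthogonal (W V a b) ≡ (orthogonal V ∧ Q b) ∧ P a
      orthogonal-W a b = orthogonal-update₂ V a b y≢z yz Vy≡0 Vz≡0
      μ-W : ∀ a b → μ (W V a b) ≡ μ V
      μ-W a b = trans (μ-y (V [ z ]≔ b) a) (μ-z V b)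
      W-y : ∀ a b → lookup (W V a b) y ≡ a
      W-y a b = lookup∘update y (V [ z ]≔ b) a
      W-z : ∀ a b → lookup (W V a b) z ≡ b
      W-z a b = trans (lookup∘update′ (y≢z ∘ sym) (V [ z ]≔ b) a) (lookup∘update z V b)
      term-g : ∀ a b → ⟦ orthogonal (W V a b) ⟧ * g (W V a b) ≡ C * ⟦ P a ∧ (Q b ∧ not (b · a)) ⟧
      term-g a b rewrite orthogonal-W a b | W-y a b | W-z a b | μ-W a b | ·-comm a b =
        ⟦⟧-regroup (orthogonal V) (Q b) (P a) (not (b · a)) (μ V)
      term-μ : ∀ a b → ⟦ orthogonal (W V a b) ⟧ * μ (W V a b) ≡ C * (⟦ P a ⟧ * ⟦ Q b ⟧)
      term-μ a b rewrite orthogonal-W a b | μ-W a b = ⟦⟧-regroup′ (orthogonal V) (Q b) (P a) (μ V)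
      fibre-g : fibre g V ≡ C * (∑[ a ∈ 𝔹^ c ] ∑[ b ∈ 𝔹^ c ] ⟦ P a ∧ (Q b ∧ not (b · a)) ⟧)
      fibre-g = trans (∑-cong (𝔹^ c) λ b → trans (∑-cong (𝔹^ c) λ a → term-g a b) (∑-*ˡ (𝔹^ c) C _))
                      (trans (∑-*ˡ (𝔹^ c) C _) (cong (C *_) (∑-swap (𝔹^ c) (𝔹^ c) _)))
      fibre-μ : fibre μ V ≡ C * (∣ P ∣ * ∣ Q ∣)
      fibre-μ = trans (∑-cong (𝔹^ c) λ b → trans (∑-cong (𝔹^ c) λ a → term-μ a b)
                                          (trans (∑-*ˡ (𝔹^ c) C _) (cong (C *_) (∑-*ʳ (𝔹^ c) ⟦ Q b ⟧ _))))
                      (trans (∑-*ˡ (𝔹^ c) C _) (cong (C *_) (∑-*ˡ (𝔹^ c) ∣ P ∣ _)))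

    per-labeling : ∀ V → 8 * (ez V * (ey V * fibre g V)) ≤ 5 * (ez V * (ey V * fibre μ V))
    per-labeling V with lookup V y ≟ᵛ 0⃗ | lookup V z ≟ᵛ 0⃗
    ... | yes Vy≡0 | yes Vz≡0 =
      8*≤5*-scale 1 {1 * fibre g V} {1 * fibre μ V} (8*≤5*-scale 1 {fibre g V} {fibre μ V} (fibre-bound V Vy≡0 Vz≡0))
    ... | yes _    | no _     = z≤n
    ... | no _     | yes _    = z≤n
    ... | no _     | no _     = z≤n

  DependsOnlyOn : (Fin n → Bool) → (Vec (Label c) n → ℕ) → Set
  DependsOnlyOn F μ = ∀ V v a → F v ≡ false → μ (V [ v ]≔ a) ≡ μ V

  -- μ weighs labelings by what the adversary has seen so far, so this bounds the conditional
  -- probability of a forgery by 5/8.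
  forgery-invariant : ∀ {k} (A : Adversary n c k) F μ → DependsOnlyOn F μ →
    8 * (∑[ V ∈ Ω ] ⟦ winsAvoiding _⊥?_ G F A (lookup V) ⟧ * μ V) ≤ 5 * (∑[ V ∈ Ω ] μ V)
  forgery-invariant (guess y z) F μ μ-dep with y ≟ z | F y in Fy | F z in Fz | adj G y z in yz
  ... | yes _   | _     | _     | _     = ≤-trans (≤-reflexive (cong (8 *_) (∑-zero Ω))) z≤n
  ... | no _    | true  | _     | _     = ≤-trans (≤-reflexive (cong (8 *_) (∑-zero Ω))) z≤n
  ... | no _    | false | true  | _     = ≤-trans (≤-reflexive (cong (8 *_) (∑-zero Ω))) z≤n
  ... | no _    | false | false | true  = ≤-trans (≤-reflexive (cong (8 *_) (∑-zero Ω))) z≤n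
  ... | no y≢z  | false | false | false = pair-bound y≢z yz μ (λ V a → μ-dep V y a Fy) (λ V b → μ-dep V z b Fz)
  forgery-invariant (query x f) F μ μ-dep = begin
    8 * (∑[ V ∈ Ω ] ⟦ wins′ (f (lookup V x)) V ⟧ * μ V)
      ≡⟨ cong (8 *_) (∑-partition (𝔹^-enumeratesOnce c) Ω (λ V → lookup V x) _) ⟩
    8 * (∑[ a ∈ 𝔹^ c ] ∑[ V ∈ Ω ] ⟦ does (a ≟ᵛ lookup V x) ⟧ * (⟦ wins′ (f (lookup V x)) V ⟧ * μ V))
      ≡⟨ cong (8 *_) (∑-cong (𝔹^ c) λ a → ∑-cong Ω (answer-fixed a)) ⟩
    8 * (∑[ a ∈ 𝔹^ c ] ∑[ V ∈ Ω ] ⟦ wins′ (f a) V ⟧ * μ′ a V)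
      ≡⟨ sym (∑-*ˡ (𝔹^ c) 8 _) ⟩
    ∑[ a ∈ 𝔹^ c ] 8 * (∑[ V ∈ Ω ] ⟦ wins′ (f a) V ⟧ * μ′ a V)
      ≤⟨ ∑-mono-≤ (𝔹^ c) (λ a → forgery-invariant (f a) F′ (μ′ a) (μ′-dep a)) ⟩
    ∑[ a ∈ 𝔹^ c ] 5 * (∑[ V ∈ Ω ] μ′ a V)
      ≡⟨ ∑-*ˡ (𝔹^ c) 5 _ ⟩
    5 * (∑[ a ∈ 𝔹^ c ] ∑[ V ∈ Ω ] μ′ a V)
      ≡⟨ cong (5 *_) (sym (∑-partition (𝔹^-enumeratesOnce c) Ω (λ V → lookup V x) μ)) ⟩
    5 * (∑[ V ∈ Ω ] μ V) ∎
    where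
    open ≤-Reasoning
    F′ : Fin n → Bool
    F′ v = F v ∨ ⌊ x ≟ v ⌋
    wins′ : Adversary n c _ → Vec (Label c) n → Bool
    wins′ B V = winsAvoiding _⊥?_ G F′ B (lookup V)
    μ′ : Label c → Vec (Label c) n → ℕ
    μ′ a V = ⟦ does (a ≟ᵛ lookup V x) ⟧ * μ V
    answer-fixed : ∀ a V → ⟦ does (a ≟ᵛ lookup V x) ⟧ * (⟦ wins′ (f (lookup V x)) V ⟧ * μ V) ≡
                           ⟦ wins′ (f a) V ⟧ * μ′ a V
    answer-fixed a V with a ≟ᵛ lookup V x
    ... | yes refl = trans (*-identityˡ _) (cong (⟦ wins′ (f a) V ⟧ *_) (sym (*-identityˡ (μ V))))
    ... | no _     = sym (*-zeroʳ ⟦ wins′ (f a) V ⟧)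
    μ′-dep : ∀ a → DependsOnlyOn F′ (μ′ a)
    μ′-dep a V v b F′v≡false = cong₂ (λ u m → ⟦ does (a ≟ᵛ u) ⟧ * m)
      (lookup∘update′ (x≢v (∨-conicalʳ _ _ F′v≡false)) V b) (μ-dep V v b (∨-conicalˡ _ _ F′v≡false))
      where
      x≢v : ⌊ x ≟ v ⌋ ≡ false → x ≢ v
      x≢v x≟v≡false with x ≟ v
      ... | no x≢v = x≢v

-- The seed space has to be some Fin (suc m), so the zero labeling is listed a second time;
-- this costs the bound 5/8 the weaker 7/8.
seedLabelings : ∀ {n} (d : ℕ) → Graph n → List (Vec (Label (labelLength d)) n)
seedLabelings d G = zeroLabeling ∷ orthogonalLabelings
  where open OrthogonalLabelings G

seedLabelings-orthogonal : ∀ {n} d (G : Graph n) i →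
  OrthogonalLabelings.orthogonal G (List.lookup (seedLabelings d G) i) ≡ true
seedLabelings-orthogonal d G zero    = OrthogonalLabelings.zeroLabeling-orthogonal G
seedLabelings-orthogonal d G (suc i) = OrthogonalLabelings.∈orthogonalLabelings⇒orthogonal G (∈-lookup i)

orthogonalityScheme : ∀ d → Scheme d (labelLength d)
orthogonalityScheme d = record
  { seeds    = λ G _ → length (OrthogonalLabelings.orthogonalLabelings G)
  ; encode   = λ G _ s → lookup (List.lookup (seedLabelings d G) s)
  ; decode   = _⊥?_
  ; complete = λ G _ s u v uv →
      cong not (OrthogonalLabelings.orthogonal-elim G (List.lookup (seedLabelings d G) s) (seedLabelings-orthogonal d G s) uv)
  }

seven-eighths : ∀ {w} W {T} → w ≤ 1 → 8 * W ≤ 5 * T → 1 ≤ T → 8 * (w + W) ≤ 7 * suc T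
seven-eighths {w} W {suc t} w≤1 8W≤5T _ = begin
  8 * (w + W)        ≡⟨ *-distribˡ-+ 8 w W ⟩
  8 * w + 8 * W      ≤⟨ +-mono-≤ (*-monoʳ-≤ 8 w≤1) 8W≤5T ⟩
  8 * 1 + 5 * suc t  ≤⟨ m≤m+n _ _ ⟩
  (8 * 1 + 5 * suc t) + suc (2 * t) ≡⟨ slack t ⟩
  7 * suc (suc t) ∎
  where
  open ≤-Reasoning
  slack : ∀ t → (8 * 1 + 5 * (1 + t)) + (1 + 2 * t) ≡ 7 * (2 + t)
  slack = solve-∀

orthogonalityScheme-forgery : ∀ d → ForgeryAtMost (orthogonalityScheme d) 7 8
orthogonalityScheme-forgery d {n} G maxDegree k _ A = begin
  8 * winCount (orthogonalityScheme d) G maxDegree A ≡⟨ cong (8 *_) winCount≡ ⟩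
  8 * (⟦ wins-on zeroLabeling ⟧ + forgeries)
    ≤⟨ seven-eighths forgeries (⟦⟧≤1 (wins-on zeroLabeling)) invariant
                     (∈-length zeroLabeling∈orthogonalLabelings) ⟩
  7 * suc (length Ω) ∎
  where
  open ≤-Reasoning
  open OrthogonalLabelings G
  open Forgery G maxDegree using (forgery-invariant)
  Ω : List (Vec (Label (labelLength d)) n)
  Ω = orthogonalLabelings
  wins-on : Vec (Label (labelLength d)) n → Bool
  wins-on V = wins _⊥?_ G (lookup V) A
  forgeries : ℕ
  forgeries = ∑[ V ∈ Ω ] ⟦ winsAvoiding _⊥?_ G (λ _ → false) A (lookup V) ⟧ * 1
  winCount≡ : winCount (orthogonalityScheme d) G maxDegree A ≡ ⟦ wins-on zeroLabeling ⟧ + forgeries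
  winCount≡ = begin-equality
    winCount (orthogonalityScheme d) G maxDegree A
      ≡⟨ length-filterᵇ (wins-on ∘ List.lookup (seedLabelings d G)) (allFin _) ⟩
    ∑[ s ∈ allFin _ ] ⟦ wins-on (List.lookup (seedLabelings d G) s) ⟧
      ≡⟨ ∑-lookup (seedLabelings d G) (⟦_⟧ ∘ wins-on) ⟩
    ⟦ wins-on zeroLabeling ⟧ + (∑[ V ∈ Ω ] ⟦ wins-on V ⟧)
      ≡⟨ cong (⟦ wins-on zeroLabeling ⟧ +_) (∑-cong Ω λ V →
           trans (cong ⟦_⟧ (wins≡winsAvoiding _⊥?_ G A (lookup V))) (sym (*-identityʳ _))) ⟩
    ⟦ wins-on zeroLabeling ⟧ + forgeries ∎
  invariant : 8 * forgeries ≤ 5 * length Ω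
  invariant = subst (λ t → 8 * forgeries ≤ 5 * t) (trans (∑-const Ω 1) (*-identityˡ _))
                    (forgery-invariant A (λ _ → false) (λ _ → 1) (λ _ _ _ _ → refl))

labelLength-≤ : ∀ d k → labelLength d ≤ 2 * (suc d * suc k)
labelLength-≤ d k = subst (_≤ 2 * (suc d * suc k)) (sym (twice d)) (*-monoʳ-≤ 2 (m≤m*n (suc d) (suc k)))
  where
  twice : ∀ d → d + (2 + d) ≡ 2 * (1 + d)
  twice = solve-∀

corollary3p4 : Σ ℕ λ C → Σ ℕ λ p → Σ ℕ λ q → p < q ×
    ((d : ℕ) → Σ ℕ λ c → c ≤ C * (suc d * suc ⌈log₂ suc d ⌉) ×
      Σ (Scheme d c) λ S → ForgeryAtMost S p q)
corollary3p4 = 2 , 7 , 8 , ≤-refl , λ d →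
  labelLength d , labelLength-≤ d ⌈log₂ suc d ⌉ , orthogonalityScheme d , orthogonalityScheme-forgery d
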